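{- Let $(S,+)$ be a commutative cancellative semigroup and let $S-S$ denote its difference group. If $A\subseteq S$ is quasi-central in $S$, then $A$ is quasi-central in $S-S$.
   Context: For a commutative cancellative semigroup $(S,+)$, the difference group $(S-S,+)$ consists of all $a-b$ with $a,b\in S$, where $a-b$ is the element with $b+(a-b)=a$; it is a commutative group and $S\subseteq S-S$. For a commutative semigroup $(X,+)$, $B\subseteq X$ and $t\in X$, write $-t+B=\{y\in X:t+y\in B\}$. $B$ is thick in $X$ if for every finite nonempty $F\subseteq X$ there is $x\in X$ with $F+x\subseteq B$; $B$ is piecewise syndetic in $X$ if there is a finite nonempty $G\subseteq X$ with $\bigcup_{t\in G}(-t+B)$ thick in $X$. A family $\langle C_F\rangle_{F\in\mathcal I}$ is downward directed if $(\mathcal I,\geq)$ is a directed set and $F\geq G$ implies $C_F\subseteq C_G$. A set $A\subseteq X$ is quasi-central in $X$ if there is a downward directed family $\langle C_F\rangle_{F\in\mathcal I}$ of subsets of $A$ such that (1) for each $F\in\mathcal I$ and each $x\in C_F$ there is $G\in\mathcal I$ with $C_G\subseteq -x+C_F$, and (2) each $C_F$ is piecewise syndetic in $X$. -}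

module Defs where

open import Level using (0ℓ)
open import Data.Product using (Σ; ∃; _×_; _,_)
open import Data.List using (List)
open import Data.List.NonEmpty using (List⁺; toList)
open import Data.List.Relation.Unary.All using (All)
open import Data.List.Relation.Unary.Any using (Any)
open import Relation.Binary.PropositionalEquality using (_≡_)
open import Relation.Unary using (Pred; _⊆_)
open import Algebra.Core using (Op₁; Op₂)
open import Algebra.Structures using (IsCommutativeSemigroup; IsAbelianGroup)
import Algebra.Definitions as AD

module _ {X : Set} (_+_ : Op₂ X) where

  -[_]+_ : X → Pred X 0ℓ → Pred X 0ℓ
  -[ t ]+ B = λ y → B (t + y)

  Thick : Pred X 0ℓ → Set
  Thick B = (F : List⁺ X) → ∃ λ x → All (λ f → B (f + x)) (toList F)

  PiecewiseSyndetic : Pred X 0ℓ → Set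
  PiecewiseSyndetic B =
    Σ (List⁺ X) λ G → Thick (λ y → Any (λ t → (-[ t ]+ B) y) (toList G))

  record IsDirected (ℐ : Set) (_≥_ : ℐ → ℐ → Set) : Set where
    field
      refl≥  : ∀ F → F ≥ F
      trans≥ : ∀ {F G H} → F ≥ G → G ≥ H → F ≥ H
      inhabited : ℐ
      upper  : ∀ F G → ∃ λ H → (H ≥ F) × (H ≥ G)

  QuasiCentral : Pred X 0ℓ → Set₁
  QuasiCentral A =
    Σ Set λ ℐ →
    Σ (ℐ → ℐ → Set) λ _≥_ →
    Σ (ℐ → Pred X 0ℓ) λ C →
      IsDirected ℐ _≥_
      × (∀ F → C F ⊆ A)
      × (∀ {F G} → F ≥ G → C F ⊆ C G)
      × (∀ F x → C F x → ∃ λ G → C G ⊆ -[ x ]+ (C F))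
      × (∀ F → PiecewiseSyndetic (C F))

Cancellative : {S : Set} → Op₂ S → Set
Cancellative {S} _+_ = AD.Cancellative {A = S} _≡_ _+_

-- The difference group S - S of a commutative cancellative semigroup
-- (S , +): a commutative group G together with an injective
-- homomorphism ι : S → G such that every element of G is of the form
-- ι a - ι b (this characterises S - S up to isomorphism over S).
record DifferenceGroup (S : Set) (_+ₛ_ : Op₂ S) : Set₁ where
  field
    Carrier : Set
    _+_     : Op₂ Carrier
    0#      : Carrier
    -_      : Op₁ Carrier
    isAbelianGroup : IsAbelianGroup _≡_ _+_ 0# -_
    ι       : S → Carrier
    ι-hom   : ∀ a b → ι (a +ₛ b) ≡ ι a + ι b
    ι-inj   : ∀ a b → ι a ≡ ι b → a ≡ b
    differences : ∀ g → ∃ λ a → ∃ λ b → g ≡ ι a + (- ι b)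

  image : Pred S 0ℓ → Pred Carrier 0ℓ
  image A g = ∃ λ a → A a × ι a ≡ g

module Submission where

-- The directed family ⟨C_F⟩ witnessing that A is quasi-central in S is
-- simply pushed forward along ι.  Inclusion in A, monotonicity and the
-- translation property (1) transfer directly because ι is an injective
-- homomorphism; the only real work is property (2):
--
--   the image of a piecewise syndetic subset of S is piecewise syndetic
--   in S - S.
--
-- Its heart is that the image of a thick set U ⊆ S is thick in S - S.
-- Given finitely many f₁, …, fₙ ∈ S - S, clear denominators: there is
-- β ∈ S with every fᵢ + ι β = ι cᵢ in ι(S).  Thickness of U gives x ∈ S
-- with all cᵢ + x ∈ U, and then fᵢ + (ι β + ι x) = ι (cᵢ + x) ∈ ι(U).
-- The union ⋃_{t ∈ G} (-t + B) is then carried into ⋃_{t ∈ ι G} (-t + ι B).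

open import Defs
open import Level using (0ℓ)
open import Relation.Unary using (Pred; _⊆_)
open import Relation.Binary.PropositionalEquality
  using (_≡_; refl; sym; cong; module ≡-Reasoning)
open import Algebra.Core using (Op₂)
open import Algebra.Bundles using (Group)
open import Algebra.Structures using (IsCommutativeSemigroup; IsAbelianGroup)
open import Data.Product using (∃; _,_; proj₁)
open import Data.List using (List; []; _∷_)
import Data.List as List
open import Data.List.NonEmpty using (_∷_; toList)
import Data.List.NonEmpty as List⁺
open import Data.List.Relation.Unary.All using (All; []; _∷_; reduce)
import Data.List.Relation.Unary.All as All
open import Data.List.Relation.Unary.Any using (Any)
import Data.List.Relation.Unary.Any as Any
open import Data.List.Relation.Unary.Any.Properties using (map⁺)

thick-mono : {X : Set} (_∙_ : Op₂ X) {U V : Pred X 0ℓ} →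
             U ⊆ V → Thick _∙_ U → Thick _∙_ V
thick-mono _∙_ U⊆V thickU F with thickU F
... | x , inU = x , All.map U⊆V inU

-- Being a directed set does not depend on the ambient semigroup (Defs
-- merely indexes the notion by it).
reindex-directed : {X Y : Set} (_∙_ : Op₂ X) (_∘_ : Op₂ Y) {ℐ : Set} {_≥_ : ℐ → ℐ → Set} →
                   IsDirected _∙_ ℐ _≥_ → IsDirected _∘_ ℐ _≥_
reindex-directed _ _ directed = record
  { refl≥ = refl≥ ; trans≥ = trans≥ ; inhabited = inhabited ; upper = upper }
  where open IsDirected directed

module DifferenceGroupProperties {S : Set} (_⊕_ : Op₂ S) (D : DifferenceGroup S _⊕_) where
  open DifferenceGroup D
  open IsAbelianGroup isAbelianGroup using (isGroup; assoc; comm)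
  open ≡-Reasoning

  group : Group 0ℓ 0ℓ
  group = record
    { Carrier = Carrier ; _≈_ = _≡_ ; _∙_ = _+_ ; ε = 0# ; _⁻¹ = -_ ; isGroup = isGroup }

  open import Algebra.Properties.Group group using (//-rightDividesˡ)

  Integral : Pred Carrier 0ℓ
  Integral g = ∃ λ c → ι c ≡ g

  integral-+ι : ∀ {g} → Integral g → ∀ b → Integral (g + ι b)
  integral-+ι (c , refl) b = c ⊕ b , ι-hom c b

  -- Every element has a "denominator": g = ι a - ι b gives g + ι b = ι a.
  denominator : ∀ g → ∃ λ b → Integral (g + ι b)
  denominator g with differences g
  ... | a , b , refl = b , a , sym (//-rightDividesˡ (ι b) (ι a))

  +ι-hom : ∀ g a b → g + ι (a ⊕ b) ≡ (g + ι a) + ι b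
  +ι-hom g a b = begin
    g + ι (a ⊕ b)      ≡⟨ cong (g +_) (ι-hom a b) ⟩
    g + (ι a + ι b)    ≡⟨ assoc g (ι a) (ι b) ⟨
    (g + ι a) + ι b    ∎

  +ι-swap : ∀ g a b → g + ι (a ⊕ b) ≡ (g + ι b) + ι a
  +ι-swap g a b = begin
    g + ι (a ⊕ b)      ≡⟨ +ι-hom g a b ⟩
    (g + ι a) + ι b    ≡⟨ assoc g (ι a) (ι b) ⟩
    g + (ι a + ι b)    ≡⟨ cong (g +_) (comm (ι a) (ι b)) ⟩
    g + (ι b + ι a)    ≡⟨ assoc g (ι b) (ι a) ⟨
    (g + ι b) + ι a    ∎

  -- Finitely many elements have a common denominator β ∈ S (the seed β₀
  -- is only needed for the empty list).
  common-denominator : S → (fs : List Carrier) → ∃ λ β → All (λ f → Integral (f + ι β)) fs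
  common-denominator β₀ [] = β₀ , []
  common-denominator β₀ (f ∷ fs) with common-denominator β₀ fs | denominator f
  ... | β , fs-integral | b , f-integral =
    b ⊕ β , head ∷ All.map tail fs-integral
    where
    head : Integral (f + ι (b ⊕ β))
    head rewrite +ι-hom f b β = integral-+ι f-integral β
    tail : ∀ {g} → Integral (g + ι β) → Integral (g + ι (b ⊕ β))
    tail {g} g-integral rewrite +ι-swap g b β = integral-+ι g-integral b

  translate-into-image : ∀ {U β x fs} (integral : All (λ f → Integral (f + ι β)) fs) →
                         All (λ c → U (c ⊕ x)) (reduce proj₁ integral) →
                         All (λ f → image U (f + (ι β + ι x))) fs
  translate-into-image [] [] = []
  translate-into-image {β = β} {x} {f ∷ _} ((c , ιc≡f+ιβ) ∷ integral) (c+x∈U ∷ rest) =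
    (c ⊕ x , c+x∈U , ι-shift) ∷ translate-into-image integral rest
    where
    ι-shift : ι (c ⊕ x) ≡ f + (ι β + ι x)
    ι-shift = begin
      ι (c ⊕ x)          ≡⟨ ι-hom c x ⟩
      ι c + ι x          ≡⟨ cong (_+ ι x) ιc≡f+ιβ ⟩
      (f + ι β) + ι x    ≡⟨ assoc f (ι β) (ι x) ⟩
      f + (ι β + ι x)    ∎

  image-thick : ∀ {U} → Thick _⊕_ U → Thick _+_ (image U)
  image-thick thickU (f ∷ fs) with differences f
  ... | a , _ with common-denominator a (f ∷ fs)
  ... | β , integral@((c , _) ∷ integral′) with thickU (c ∷ reduce proj₁ integral′)
  ... | x , cs+x∈U = ι β + ι x , translate-into-image integral cs+x∈U

  image-mono : ∀ {B B′} → B ⊆ B′ → image B ⊆ image B′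
  image-mono B⊆B′ (a , a∈B , refl) = a , B⊆B′ a∈B , refl

  image-translate : ∀ {x B B′} → B ⊆ -[_]+_ _⊕_ x B′ → image B ⊆ -[_]+_ _+_ (ι x) (image B′)
  image-translate {x} B⊆-x+B′ (y , y∈B , refl) = x ⊕ y , B⊆-x+B′ y∈B , ι-hom x y

  image-union : ∀ {B} (G : List S) →
                image (λ y → Any (λ t → B (t ⊕ y)) G) ⊆
                (λ g → Any (λ t → image B (t + g)) (List.map ι G))
  image-union G (y , y∈⋃ , refl) =
    map⁺ (Any.map (λ {t} t+y∈B → t ⊕ y , t+y∈B , ι-hom t y) y∈⋃)

  image-piecewise-syndetic : ∀ {B} → PiecewiseSyndetic _⊕_ B → PiecewiseSyndetic _+_ (image B)
  image-piecewise-syndetic {B} (G , thick⋃) =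
    List⁺.map ι G , thick-mono _+_ {U = image ⋃G} (image-union (toList G)) (image-thick thick⋃)
    where
    ⋃G : Pred S 0ℓ
    ⋃G y = Any (λ t → B (t ⊕ y)) (toList G)

theorem2p3 : (S : Set) (_+_ : Op₂ S) → IsCommutativeSemigroup _≡_ _+_ → Cancellative _+_ →
    (D : DifferenceGroup S _+_) (A : Pred S 0ℓ) →
    QuasiCentral _+_ A → QuasiCentral (DifferenceGroup._+_ D) (DifferenceGroup.image D A)
theorem2p3 S _⊕_ _ _ D A (ℐ , _≥_ , C , directed , C⊆A , C-mono , C-shift , C-ps) =
  ℐ , _≥_ , (λ F → image (C F)) ,
  reindex-directed _⊕_ _+_ directed ,
  (λ F → image-mono (C⊆A F)) ,
  (λ F≥G → image-mono (C-mono F≥G)) ,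
  image-shift ,
  (λ F → image-piecewise-syndetic (C-ps F))
  where
  open DifferenceGroup D
  open DifferenceGroupProperties _⊕_ D
  image-shift : ∀ F g → image (C F) g → ∃ λ G → image (C G) ⊆ -[_]+_ _+_ g (image (C F))
  image-shift F g (x , x∈C , refl) with C-shift F x x∈C
  ... | G , C-G⊆-x+C-F = G , image-translate C-G⊆-x+C-F
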